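{- Let $S\subseteq\mathbb N^2$ be a symmetric local good semigroup with minimal nonzero element $\boldsymbol e$, and suppose $\Delta^S(\boldsymbol e)\neq\emptyset$. Then every absolute element of $S$ belongs to $\mathrm{Ap}(S,\boldsymbol e)=S\setminus(\boldsymbol e+S)$.
   Context: Notation: for $\boldsymbol\alpha,\boldsymbol\beta\in\mathbb Z^2$, $\le$ is componentwise and $\wedge$ is the componentwise minimum. A good semigroup is a submonoid $S\subseteq\mathbb N^2$ with (G1) closure under $\wedge$; (G2) if $\boldsymbol\alpha\neq\boldsymbol\beta\in S$ and $\alpha_i=\beta_i$ for some $i$, there is $\boldsymbol\epsilon\in S$ with $\epsilon_i>\alpha_i$ and $\epsilon_j\ge\min(\alpha_j,\beta_j)$ for $j\ne i$, with equality if $\alpha_j\ne\beta_j$; (G3) $\boldsymbol c+\mathbb N^2\subseteq S$ for some $\boldsymbol c$. Its conductor $\boldsymbol c$ is the minimal such element and $\boldsymbol\gamma=\boldsymbol c-(1,1)$. $S$ is local if $\boldsymbol 0$ is its only element with a zero component; $\boldsymbol e$ is the minimal element of $S$ with all coordinates positive. For $i\in\{1,2\}$: $\Delta^S_i(\boldsymbol\alpha)=\{\boldsymbol\beta\in S:\beta_i=\alpha_i,\ \beta_j>\alpha_j\ (j\ne i)\}$, $\Delta^S(\boldsymbol\alpha)=\Delta^S_1(\boldsymbol\alpha)\cup\Delta^S_2(\boldsymbol\alpha)$. An element $\boldsymbol\alpha\in S$ is absolute if $\Delta^S(\boldsymbol\alpha)=\emptyset$. $S$ is symmetric if for every $\boldsymbol\alpha\in\mathbb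 Z^2$: $\boldsymbol\alpha\in S$ iff $\Delta^S(\boldsymbol\gamma-\boldsymbol\alpha)=\emptyset$. -}

module Defs where

open import Data.Nat using (ℕ; zero; suc; _+_; _≤_; _<_; _⊓_)
open import Data.Integer as ℤ using (ℤ; +_)
open import Data.Product using (Σ; ∃; ∃-syntax; _×_; _,_)
open import Data.Sum using (_⊎_)
open import Data.Empty using (⊥)
open import Relation.Nullary using (¬_)
open import Relation.Binary.PropositionalEquality using (_≡_; _≢_)
open import Function.Bundles using (_⇔_)

Subset² : Set₁
Subset² = ℕ → ℕ → Set

record IsSubmonoid (S : Subset²) : Set where
  field
    zero∈ : S 0 0
    +-closed : ∀ {a₁ a₂ b₁ b₂} → S a₁ a₂ → S b₁ b₂ → S (a₁ + b₁) (a₂ + b₂)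

G1 : Subset² → Set
G1 S = ∀ {a₁ a₂ b₁ b₂} → S a₁ a₂ → S b₁ b₂ → S (a₁ ⊓ b₁) (a₂ ⊓ b₂)

-- (G2), written out for i = 1 (j = 2) and i = 2 (j = 1)
G2 : Subset² → Set
G2 S =
  (∀ {a₁ a₂ b₁ b₂} → S a₁ a₂ → S b₁ b₂ → (a₁ , a₂) ≢ (b₁ , b₂) → a₁ ≡ b₁ →
     ∃[ ε₁ ] ∃[ ε₂ ] (S ε₁ ε₂ × a₁ < ε₁ × (a₂ ⊓ b₂) ≤ ε₂ × (a₂ ≢ b₂ → ε₂ ≡ a₂ ⊓ b₂)))
  ×
  (∀ {a₁ a₂ b₁ b₂} → S a₁ a₂ → S b₁ b₂ → (a₁ , a₂) ≢ (b₁ , b₂) → a₂ ≡ b₂ →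
     ∃[ ε₁ ] ∃[ ε₂ ] (S ε₁ ε₂ × a₂ < ε₂ × (a₁ ⊓ b₁) ≤ ε₁ × (a₁ ≢ b₁ → ε₁ ≡ a₁ ⊓ b₁)))

UpperClosedFrom : Subset² → ℕ → ℕ → Set
UpperClosedFrom S c₁ c₂ = ∀ m n → S (c₁ + m) (c₂ + n)

G3 : Subset² → Set
G3 S = ∃[ c₁ ] ∃[ c₂ ] UpperClosedFrom S c₁ c₂

record IsGoodSemigroup (S : Subset²) : Set where
  field
    submonoid : IsSubmonoid S
    g1 : G1 S
    g2 : G2 S
    g3 : G3 S

IsConductor : Subset² → ℕ → ℕ → Set
IsConductor S c₁ c₂ =
  UpperClosedFrom S c₁ c₂ × (∀ d₁ d₂ → UpperClosedFrom S d₁ d₂ → c₁ ≤ d₁ × c₂ ≤ d₂)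

IsLocal : Subset² → Set
IsLocal S = ∀ {m n} → S m n → (m ≡ 0 ⊎ n ≡ 0) → (m ≡ 0 × n ≡ 0)

IsMinPositive : Subset² → ℕ → ℕ → Set
IsMinPositive S e₁ e₂ =
  S e₁ e₂ × 0 < e₁ × 0 < e₂ ×
  (∀ {b₁ b₂} → S b₁ b₂ → 0 < b₁ → 0 < b₂ → e₁ ≤ b₁ × e₂ ≤ b₂)

Δ₁ : Subset² → ℤ → ℤ → ℕ → ℕ → Set
Δ₁ S a₁ a₂ b₁ b₂ = S b₁ b₂ × (+ b₁ ≡ a₁) × (a₂ ℤ.< + b₂)

Δ₂ : Subset² → ℤ → ℤ → ℕ → ℕ → Set
Δ₂ S a₁ a₂ b₁ b₂ = S b₁ b₂ × (+ b₂ ≡ a₂) × (a₁ ℤ.< + b₁)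

Δ : Subset² → ℤ → ℤ → ℕ → ℕ → Set
Δ S a₁ a₂ b₁ b₂ = Δ₁ S a₁ a₂ b₁ b₂ ⊎ Δ₂ S a₁ a₂ b₁ b₂

ΔEmpty : Subset² → ℤ → ℤ → Set
ΔEmpty S a₁ a₂ = ∀ b₁ b₂ → ¬ Δ S a₁ a₂ b₁ b₂

_∈ℤ_ : ℤ × ℤ → Subset² → Set
(a₁ , a₂) ∈ℤ S = ∃[ m ] ∃[ n ] (a₁ ≡ + m × a₂ ≡ + n × S m n)

IsAbsolute : Subset² → ℕ → ℕ → Set
IsAbsolute S a₁ a₂ = S a₁ a₂ × ΔEmpty S (+ a₁) (+ a₂)

-- Symmetric, with respect to the conductor c (γ = c - (1,1)):
-- for every α ∈ ℤ², α ∈ S iff Δ^S(γ - α) = ∅.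
IsSymmetric : Subset² → ℕ → ℕ → Set
IsSymmetric S c₁ c₂ = ∀ (a₁ a₂ : ℤ) →
  ((a₁ , a₂) ∈ℤ S) ⇔ ΔEmpty S ((+ c₁ ℤ.- ℤ.1ℤ) ℤ.- a₁) ((+ c₂ ℤ.- ℤ.1ℤ) ℤ.- a₂)

InApery : Subset² → ℕ → ℕ → ℕ → ℕ → Set
InApery S e₁ e₂ a₁ a₂ =
  S a₁ a₂ × ¬ (∃[ b₁ ] ∃[ b₂ ] (S b₁ b₂ × a₁ ≡ e₁ + b₁ × a₂ ≡ e₂ + b₂))

module Submission where

-- The hypothesis Δ^S(e) ≠ ∅ alone forces the conclusion: if δ ∈ Δ^S(e) and
-- α = e + β with β ∈ S, then δ + β ∈ Δ^S(α), so α is not absolute.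

open import Defs
open import Data.Nat using (ℕ; _+_)
open import Data.Nat.Properties using (+-monoˡ-<)
open import Data.Integer using (+_; +<+)
open import Data.Product using (∃-syntax; _,_)
open import Data.Sum using (inj₁; inj₂)
open import Relation.Nullary using (¬_)
open import Relation.Binary.PropositionalEquality using (refl)

module _ {S : Subset²} (submonoid : IsSubmonoid S) where
  open IsSubmonoid submonoid

  Δ-+-translate : ∀ {a₁ a₂ b₁ b₂ t₁ t₂} → S t₁ t₂ → Δ S (+ a₁) (+ a₂) b₁ b₂ →
    Δ S (+ (a₁ + t₁)) (+ (a₂ + t₂)) (b₁ + t₁) (b₂ + t₂)
  Δ-+-translate {t₁ = t₁} {t₂} tS (inj₁ (bS , refl , +<+ a₂<b₂)) =
    inj₁ (+-closed bS tS , refl , +<+ (+-monoˡ-< t₂ a₂<b₂))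
  Δ-+-translate {t₁ = t₁} {t₂} tS (inj₂ (bS , refl , +<+ a₁<b₁)) =
    inj₂ (+-closed bS tS , refl , +<+ (+-monoˡ-< t₁ a₁<b₁))

  ΔNonEmpty-+-translate : ∀ {a₁ a₂ t₁ t₂} → S t₁ t₂ →
    (∃[ b₁ ] ∃[ b₂ ] Δ S (+ a₁) (+ a₂) b₁ b₂) →
    ¬ ΔEmpty S (+ (a₁ + t₁)) (+ (a₂ + t₂))
  ΔNonEmpty-+-translate tS (_ , _ , δ) empty =
    empty _ _ (Δ-+-translate tS δ)

lemma6p3 : (S : Subset²) (c₁ c₂ e₁ e₂ : ℕ) →
    IsGoodSemigroup S → IsConductor S c₁ c₂ → IsLocal S → IsSymmetric S c₁ c₂ →
    IsMinPositive S e₁ e₂ →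
    (∃[ b₁ ] ∃[ b₂ ] Δ S (+ e₁) (+ e₂) b₁ b₂) →
    ∀ (a₁ a₂ : ℕ) → IsAbsolute S a₁ a₂ → InApery S e₁ e₂ a₁ a₂
lemma6p3 S c₁ c₂ e₁ e₂ good _ _ _ _ Δe≠∅ a₁ a₂ (aS , Δa=∅) =
  aS , λ { (b₁ , b₂ , bS , refl , refl) →
             ΔNonEmpty-+-translate (IsGoodSemigroup.submonoid good) bS Δe≠∅ Δa=∅ }
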